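{- Let $\mathbf A$ be an iMTL-algebra enriched with a metric. If $S\subseteq W_1\times W_2$ is a simulation between $\mathbf A$-paraconsistent Kripke models $M_1$ and $M_2$ and $(w_1,w_2)\in S$, then $(w_1\models\varphi)\preccurlyeq(w_2\models\varphi)$ for every formula $\varphi$ of the positive fragment with the modal connective $\Diamond$ (i.e. built from propositions, $\bot$, $\wedge$, $\vee$ and $\Diamond$ only; no $\neg$, $\to$, $\Box$, negative modalities or consistency connective $\circ$).
   Context: An iMTL-algebra $\mathbf A=\langle A,\sqcap,\sqcup,1,0,\rightharpoonup\rangle$ is a complete lattice with top $1$, bottom $0$, residuum $\rightharpoonup$ ($a\sqcap b\le c$ iff $b\le a\rightharpoonup c$) and prelinearity $(a\rightharpoonup b)\sqcup(b\rightharpoonup a)=1$, here also equipped with a metric on $A$. Write $\inf$/$\sup$ for arbitrary meets/joins. Pairs are ordered by $(a,b)\preccurlyeq(c,d)$ iff $a\le c$ and $b\ge d$; for $x=(a,b)$, $x^+=a$, $x^-=b$. An $\mathbf A$-paraconsistent Kripke model $M=(W,R,V)$ has finite nonempty $W$, $R\subseteq W\times W\times A\times A$ with at most one tuple per pair of states (written $w\xrightarrow{(a,b)}w'$), $R^+(w,w')=a$, $R^-(w,w')=b$ if $(w,w',a,b)\in R$ (both $0$ otherwise), $R[w]$ the successors of $w$, and $V:\mathrm{Prop}\times W\to A\times A$. Satisfaction: $(w\models p)=V(p,w)$; $(w\models\bot)=(0,1)$; if $(w\models\varphi_1)=(a,b)$, $(w\models\varphi_2)=(c,d)$ then $(w\models\varphi_1\wedge\varphi_2)=(a\sqcap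 c,b\sqcup d)$, $(w\models\varphi_1\vee\varphi_2)=(a\sqcup c,b\sqcap d)$; $(w\models\Diamond\varphi)=(\sup_{w'\in R[w]}(R^+(w,w')\sqcap(w'\models\varphi)^+),\ \inf_{w'\in R[w]}(R^+(w,w')\rightharpoonup(w'\models\varphi)^-))$. A relation $S\subseteq W_1\times W_2$ is a simulation between $M_1=(W_1,R_1,V_1)$ and $M_2=(W_2,R_2,V_2)$ if for every $(w_1,w_2)\in S$: whenever $w_1\xrightarrow{(a,b)}w_1'$ in $M_1$ there are $w_2'\in W_2$ and $(a',b')$ with $w_2\xrightarrow{(a',b')}w_2'$ in $M_2$, $(w_1',w_2')\in S$ and $(a,b)\preccurlyeq(a',b')$; and for every $p\in\mathrm{Prop}$, $V_1(p,w_1)\preccurlyeq V_2(p,w_2)$. -}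

module Defs where

open import Data.Nat using (ℕ; suc)
open import Data.Fin using (Fin)
open import Data.Maybe using (Maybe; just; nothing)
open import Data.Product using (Σ; _×_; _,_; proj₁; proj₂)
open import Relation.Binary.PropositionalEquality using (_≡_)

record IMTL : Set₁ where
  field
    Carrier : Set
    _≤_     : Carrier → Carrier → Set
    ≤-refl  : ∀ {a} → a ≤ a
    ≤-trans : ∀ {a b c} → a ≤ b → b ≤ c → a ≤ c
    ≤-antisym : ∀ {a b} → a ≤ b → b ≤ a → a ≡ b
    _⊓_ _⊔_ : Carrier → Carrier → Carrier
    ⊓-lb₁ : ∀ a b → (a ⊓ b) ≤ a
    ⊓-lb₂ : ∀ a b → (a ⊓ b) ≤ b
    ⊓-glb : ∀ {a b c} → c ≤ a → c ≤ b → c ≤ (a ⊓ b)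
    ⊔-ub₁ : ∀ a b → a ≤ (a ⊔ b)
    ⊔-ub₂ : ∀ a b → b ≤ (a ⊔ b)
    ⊔-lub : ∀ {a b c} → a ≤ c → b ≤ c → (a ⊔ b) ≤ c
    sup : {I : Set} → (I → Carrier) → Carrier
    inf : {I : Set} → (I → Carrier) → Carrier
    sup-ub  : ∀ {I} (f : I → Carrier) (i : I) → f i ≤ sup f
    sup-lub : ∀ {I} (f : I → Carrier) {c} → (∀ i → f i ≤ c) → sup f ≤ c
    inf-lb  : ∀ {I} (f : I → Carrier) (i : I) → inf f ≤ f i
    inf-glb : ∀ {I} (f : I → Carrier) {c} → (∀ i → c ≤ f i) → c ≤ inf f
    𝟙 𝟘 : Carrier
    𝟙-top : ∀ a → a ≤ 𝟙
    𝟘-bot : ∀ a → 𝟘 ≤ a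
    _⇀_ : Carrier → Carrier → Carrier
    resid₁ : ∀ {a b c} → (a ⊓ b) ≤ c → b ≤ (a ⇀ c)
    resid₂ : ∀ {a b c} → b ≤ (a ⇀ c) → (a ⊓ b) ≤ c
    prelinear : ∀ a b → ((a ⇀ b) ⊔ (b ⇀ a)) ≡ 𝟙

-- A-paraconsistent Kripke model over propositions Prop.
-- W = Fin (suc n): finite and nonempty.  R w w' = just (a , b) means
-- w --(a,b)--> w'; nothing means no tuple (at most one tuple per pair).
record Model (𝐀 : IMTL) (Prop : Set) : Set where
  field
    n : ℕ
    R : Fin (suc n) → Fin (suc n) → Maybe (IMTL.Carrier 𝐀 × IMTL.Carrier 𝐀)
    V : Prop → Fin (suc n) → IMTL.Carrier 𝐀 × IMTL.Carrier 𝐀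

open Model public

module _ (𝐀 : IMTL) where
  open IMTL 𝐀

  _≼_ : Carrier × Carrier → Carrier × Carrier → Set
  (a , b) ≼ (c , d) = (a ≤ c) × (d ≤ b)

  Succ : ∀ {Prop} (M : Model 𝐀 Prop) → Fin (suc (n M)) → Set
  Succ M w = Σ (Fin (suc (n M))) λ w' → Σ (Carrier × Carrier) λ l → R M w w' ≡ just l

data PosForm (Prop : Set) : Set where
  atom : Prop → PosForm Prop
  ⊥′   : PosForm Prop
  _∧′_ : PosForm Prop → PosForm Prop → PosForm Prop
  _∨′_ : PosForm Prop → PosForm Prop → PosForm Prop
  ◇    : PosForm Prop → PosForm Prop

module _ (𝐀 : IMTL) {Prop : Set} (M : Model 𝐀 Prop) where
  open IMTL 𝐀

  sat : Fin (suc (n M)) → PosForm Prop → Carrier × Carrier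
  sat w (atom p) = V M p w
  sat w ⊥′ = 𝟘 , 𝟙
  sat w (φ ∧′ ψ) = (proj₁ (sat w φ) ⊓ proj₁ (sat w ψ)) , (proj₂ (sat w φ) ⊔ proj₂ (sat w ψ))
  sat w (φ ∨′ ψ) = (proj₁ (sat w φ) ⊔ proj₁ (sat w ψ)) , (proj₂ (sat w φ) ⊓ proj₂ (sat w ψ))
  sat w (◇ φ) =
    sup {Succ 𝐀 M w} (λ s → proj₁ (proj₁ (proj₂ s)) ⊓ proj₁ (sat (proj₁ s) φ)) ,
    inf {Succ 𝐀 M w} (λ s → proj₁ (proj₁ (proj₂ s)) ⇀ proj₂ (sat (proj₁ s) φ))

record IsSimulation (𝐀 : IMTL) {Prop : Set} (M₁ M₂ : Model 𝐀 Prop)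
    (S : Fin (suc (n M₁)) → Fin (suc (n M₂)) → Set) : Set where
  open IMTL 𝐀
  field
    forth : ∀ {w₁ w₂} → S w₁ w₂ → ∀ {w₁' l} → R M₁ w₁ w₁' ≡ just l →
      Σ (Fin (suc (n M₂))) λ w₂' → Σ (Carrier × Carrier) λ l' →
        (R M₂ w₂ w₂' ≡ just l') × S w₁' w₂' × _≼_ 𝐀 l l'
    atoms : ∀ {w₁ w₂} → S w₁ w₂ → ∀ (p : Prop) → _≼_ 𝐀 (V M₁ p w₁) (V M₂ p w₂)

{-# OPTIONS --safe #-}
module Submission where

open import Defs
open import Data.Nat using (suc)
open import Data.Fin using (Fin)
open import Data.Product using (Σ; _×_; _,_; proj₁; proj₂)

-- The connectives ∧ and ∨ are monotone for ≼, and so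
-- is ◇: its truth value is a join of l⁺ ⊓ φ⁺ and its falsity a meet of
-- l⁺ ⇀ φ⁻, with ⇀ antitone in l⁺. The simulation matches every successor of w₁
-- with a successor of w₂ carrying a larger label, so each term of the join
-- (meet) on the M₁ side is bounded by a term on the M₂ side.

module IMTLProperties (𝐀 : IMTL) where
  open IMTL 𝐀

  ⊓-mono : ∀ {a b c d} → a ≤ c → b ≤ d → (a ⊓ b) ≤ (c ⊓ d)
  ⊓-mono {a} {b} a≤c b≤d = ⊓-glb (≤-trans (⊓-lb₁ a b) a≤c) (≤-trans (⊓-lb₂ a b) b≤d)

  ⊔-mono : ∀ {a b c d} → a ≤ c → b ≤ d → (a ⊔ b) ≤ (c ⊔ d)
  ⊔-mono {c = c} {d} a≤c b≤d = ⊔-lub (≤-trans a≤c (⊔-ub₁ c d)) (≤-trans b≤d (⊔-ub₂ c d))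

  ⇀-mono : ∀ {a b c d} → c ≤ a → b ≤ d → (a ⇀ b) ≤ (c ⇀ d)
  ⇀-mono c≤a b≤d = resid₁ (≤-trans (⊓-mono c≤a ≤-refl) (≤-trans (resid₂ ≤-refl) b≤d))

  sup-mono : ∀ {I J} (f : I → Carrier) (g : J → Carrier) →
             (∀ i → Σ J λ j → f i ≤ g j) → sup f ≤ sup g
  sup-mono f g dominated = sup-lub f λ i →
    let (j , fi≤gj) = dominated i in ≤-trans fi≤gj (sup-ub g j)

  inf-mono : ∀ {I J} (f : I → Carrier) (g : J → Carrier) →
             (∀ i → Σ J λ j → g j ≤ f i) → inf g ≤ inf f
  inf-mono f g dominated = inf-glb f λ i →
    let (j , gj≤fi) = dominated i in ≤-trans (inf-lb g j) gj≤fi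

module _ (𝐀 : IMTL) {Prop : Set} {M₁ M₂ : Model 𝐀 Prop}
         {S : Fin (suc (n M₁)) → Fin (suc (n M₂)) → Set}
         (sim : IsSimulation 𝐀 M₁ M₂ S) where
  open IsSimulation sim

  simulation-succ : ∀ {w₁ w₂} → S w₁ w₂ → (s : Succ 𝐀 M₁ w₁) →
    Σ (Succ 𝐀 M₂ w₂) λ t → S (proj₁ s) (proj₁ t) × _≼_ 𝐀 (proj₁ (proj₂ s)) (proj₁ (proj₂ t))
  simulation-succ rel (w₁' , l , edge) =
    let (w₂' , l' , edge' , rel' , l≼l') = forth rel edge in (w₂' , l' , edge') , rel' , l≼l'

lemma3 : (𝐀 : IMTL) {Prop : Set} (M₁ M₂ : Model 𝐀 Prop)
    (S : Fin (suc (n M₁)) → Fin (suc (n M₂)) → Set) →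
    IsSimulation 𝐀 M₁ M₂ S →
    ∀ w₁ w₂ → S w₁ w₂ → (φ : PosForm Prop) →
    _≼_ 𝐀 (sat 𝐀 M₁ w₁ φ) (sat 𝐀 M₂ w₂ φ)
lemma3 𝐀 M₁ M₂ S sim = preserved
  where
  open IMTL 𝐀
  open IMTLProperties 𝐀
  open IsSimulation sim

  preserved : ∀ w₁ w₂ → S w₁ w₂ → (φ : PosForm _) → _≼_ 𝐀 (sat 𝐀 M₁ w₁ φ) (sat 𝐀 M₂ w₂ φ)
  preserved w₁ w₂ rel (atom p) = atoms rel p
  preserved w₁ w₂ rel ⊥′ = ≤-refl , ≤-refl
  preserved w₁ w₂ rel (φ ∧′ ψ) with preserved w₁ w₂ rel φ | preserved w₁ w₂ rel ψ
  ... | φ⁺ , φ⁻ | ψ⁺ , ψ⁻ = ⊓-mono φ⁺ ψ⁺ , ⊔-mono φ⁻ ψ⁻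
  preserved w₁ w₂ rel (φ ∨′ ψ) with preserved w₁ w₂ rel φ | preserved w₁ w₂ rel ψ
  ... | φ⁺ , φ⁻ | ψ⁺ , ψ⁻ = ⊔-mono φ⁺ ψ⁺ , ⊓-mono φ⁻ ψ⁻
  preserved w₁ w₂ rel (◇ φ) =
    sup-mono _ _ (λ s → let (t , rel' , l⁺ , _) = simulation-succ 𝐀 sim rel s in
                        t , ⊓-mono l⁺ (proj₁ (preserved _ _ rel' φ))) ,
    inf-mono _ _ (λ s → let (t , rel' , l⁺ , _) = simulation-succ 𝐀 sim rel s in
                        t , ⇀-mono l⁺ (proj₂ (preserved _ _ rel' φ)))
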